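{- Let $X$ be a type and $f:X\to X$. The following are logically equivalent. (i) $f$ has a splitting $(A,r,s,H,K)$ in which $s$ is an embedding. (ii) There is $I:\prod_{x:X}(f(f(x))=f(x))$, and for every $x:X$ the type $f(x)=x$ admits a weakly constant endofunction.
   Context: Intensional Martin-Löf type theory; no extensionality axioms are assumed. A splitting of $f$ consists of a type $A$, maps $r:X\to A$ and $s:A\to X$, and homotopies $H:\prod_{a:A}(r(s(a))=a)$ and $K:\prod_{x:X}(s(r(x))=f(x))$. $s:A\to X$ is an embedding if for every $x:X$ the type $\sum_{a:A}(s(a)=x)$ is a mere proposition, i.e. any two of its elements are equal. A function $g:T\to T$ is weakly constant if $\prod_{u,v:T}(g(u)=g(v))$. -}

{-# OPTIONS --without-K #-}
module Defs where

open import Level using (Level; suc)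
open import Data.Product using (Σ; Σ-syntax)
open import Relation.Binary.PropositionalEquality using (_≡_)

isProp : ∀ {ℓ} → Set ℓ → Set ℓ
isProp P = (a b : P) → a ≡ b

isEmbedding : ∀ {ℓ ℓ'} {A : Set ℓ} {X : Set ℓ'} → (A → X) → Set (ℓ Level.⊔ ℓ')
isEmbedding {A = A} {X = X} s = (x : X) → isProp (Σ[ a ∈ A ] (s a ≡ x))

WeaklyConstant : ∀ {ℓ} {T : Set ℓ} → (T → T) → Set ℓ
WeaklyConstant {T = T} g = (u v : T) → g u ≡ g v

HasWConstEndo : ∀ {ℓ} → Set ℓ → Set ℓ
HasWConstEndo T = Σ[ g ∈ (T → T) ] WeaklyConstant g

record Splitting {ℓ} {X : Set ℓ} (f : X → X) : Set (suc ℓ) where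
  field
    A : Set ℓ
    r : X → A
    s : A → X
    H : (a : A) → r (s a) ≡ a
    K : (x : X) → s (r x) ≡ f x

{-# OPTIONS --without-K #-}
module Submission where

-- (i ⇒ ii)  Given a splitting (A, r, s, H, K) of f, every point y in the
-- image of s satisfies f y ≡ y (via K and H).  Taking y = f x yields the
-- idempotence witness I.  Moreover f x ≡ x maps to the fibre of s over x
-- (by a ↦ r x) and back (by the fact just stated), so, the fibre being a
-- proposition, the composite is a weakly constant endofunction of f x ≡ x.
--
-- (ii ⇒ i)  The key fact (Kraus–Escardó–Coquand–Altenkirch) is that the
-- fixed points of a weakly constant endofunction form a proposition.  Hence
-- A = Σ x, Fix (g x) with g x the given weakly constant endofunction of
-- f x ≡ x is a family of propositions over X, so its first projection s is
-- an embedding; r x = f x together with the fixed point g (f x) (I x) of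
-- g (f x), and K holds definitionally, H by propositionality of fibres.

open import Defs
open import Level using (Level)
open import Data.Product using (Σ; Σ-syntax; _,_; proj₁; proj₂)
open import Relation.Binary.PropositionalEquality
  using (_≡_; refl; sym; trans; cong; module ≡-Reasoning)
open import Relation.Binary.PropositionalEquality.Properties
  using (trans-symˡ; trans-symʳ; trans-reflʳ; trans-assoc)
open import Function.Bundles using (_⇔_; mk⇔)

private
  variable
    a b : Level

Fix : {T : Set a} → (T → T) → Set a
Fix {T = T} g = Σ[ p ∈ T ] g p ≡ p

Fix-≡ : {T : Set a} (g : T → T) {p q : T} (α : p ≡ q) (e : g p ≡ p) (e′ : g q ≡ q) →
        trans e α ≡ trans (cong g α) e′ → _≡_ {A = Fix g} (p , e) (q , e′)
Fix-≡ g {p} refl e e′ h = cong (p ,_) (trans (sym (trans-reflʳ e)) h)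

module WeaklyConstantFix {T : Set a} (g : T → T) (c : WeaklyConstant g) where

  cong-wconst : ∀ {u v} (α : u ≡ v) → cong g α ≡ trans (sym (c u u)) (c u v)
  cong-wconst {u} refl = sym (trans-symˡ (c u u))

  Fix-isProp : isProp (Fix g)
  Fix-isProp (p , e) (q , e′) = Fix-≡ g α e e′ (trans lhs (sym rhs))
    where
      open ≡-Reasoning
      γ : g p ≡ q
      γ = trans (sym (c p p)) (trans (c p q) e′)
      α : p ≡ q
      α = trans (sym e) γ
      lhs : trans e α ≡ γ
      lhs = begin
        trans e (trans (sym e) γ)  ≡⟨ sym (trans-assoc e) ⟩
        trans (trans e (sym e)) γ  ≡⟨ cong (λ z → trans z γ) (trans-symʳ e) ⟩
        γ                          ∎
      rhs : trans (cong g α) e′ ≡ γ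
      rhs = begin
        trans (cong g α) e′                           ≡⟨ cong (λ z → trans z e′) (cong-wconst α) ⟩
        trans (trans (sym (c p p)) (c p q)) e′        ≡⟨ trans-assoc (sym (c p p)) ⟩
        γ                                             ∎

module PropFamily {X : Set a} (B : X → Set b) (B-isProp : (x : X) → isProp (B x)) where

  Σ-≡-prop : ∀ {x y} (p : x ≡ y) (u : B x) (v : B y) → _≡_ {A = Σ X B} (x , u) (y , v)
  Σ-≡-prop {x} refl u v = cong (x ,_) (B-isProp x u v)

  proj₁-isEmbedding : isEmbedding (proj₁ {B = B})
  proj₁-isEmbedding x ((.x , u) , refl) ((.x , v) , refl) =
    cong (λ w → ((x , w) , refl)) (B-isProp x u v)

wconst-via-prop : {T : Set a} {P : Set b} → isProp P → (T → P) → (P → T) → HasWConstEndo T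
wconst-via-prop P-isProp to from =
  (λ t → from (to t)) , λ u v → cong from (P-isProp (to u) (to v))

module SplittingFacts {ℓ} {X : Set ℓ} {f : X → X} (S : Splitting f) where
  open Splitting S

  image-fixed : (x : X) → Σ[ a ∈ A ] (s a ≡ x) → f x ≡ x
  image-fixed .(s a) (a , refl) = trans (sym (K (s a))) (cong s (H a))

  idempotent : (x : X) → f (f x) ≡ f x
  idempotent x = image-fixed (f x) (r x , K x)

  fixed-image : (x : X) → f x ≡ x → Σ[ a ∈ A ] (s a ≡ x)
  fixed-image x p = r x , trans (K x) p

split-embedding⇒idempotent-wconst : ∀ {ℓ} {X : Set ℓ} {f : X → X} →
  (Σ[ S ∈ Splitting f ] isEmbedding (Splitting.s S)) →
  Σ[ I ∈ ((x : X) → f (f x) ≡ f x) ] ((x : X) → HasWConstEndo (f x ≡ x))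
split-embedding⇒idempotent-wconst (S , s-emb) =
  idempotent , λ x → wconst-via-prop (s-emb x) (fixed-image x) (image-fixed x)
  where open SplittingFacts S

idempotent-wconst⇒split-embedding : ∀ {ℓ} {X : Set ℓ} {f : X → X} →
  Σ[ I ∈ ((x : X) → f (f x) ≡ f x) ] ((x : X) → HasWConstEndo (f x ≡ x)) →
  Σ[ S ∈ Splitting f ] isEmbedding (Splitting.s S)
idempotent-wconst⇒split-embedding {X = X} {f} (I , W) = S , proj₁-isEmbedding
  where
    g : (x : X) → f x ≡ x → f x ≡ x
    g x = proj₁ (W x)
    FixFamily : X → Set _
    FixFamily x = Fix (g x)
    FixFamily-isProp : (x : X) → isProp (FixFamily x)
    FixFamily-isProp x = WeaklyConstantFix.Fix-isProp (g x) (proj₂ (W x))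
    open PropFamily FixFamily FixFamily-isProp
    -- r x pairs f x with the fixed point g (f x) (I x); H holds because a
    -- point (y , p , e) of A is reached from f y along p : f y ≡ y.
    S : Splitting f
    S = record
      { A = Σ X FixFamily
      ; r = λ x → f x , g (f x) (I x) , proj₂ (W (f x)) _ _
      ; s = proj₁
      ; H = λ { (y , fixed) → Σ-≡-prop (proj₁ fixed) _ fixed }
      ; K = λ x → refl
      }

theorem3p10 : ∀ {ℓ} {X : Set ℓ} (f : X → X) →
    (Σ[ S ∈ Splitting f ] isEmbedding (Splitting.s S))
    ⇔ (Σ[ I ∈ ((x : X) → f (f x) ≡ f x) ] ((x : X) → HasWConstEndo (f x ≡ x)))
theorem3p10 f = mk⇔ split-embedding⇒idempotent-wconst idempotent-wconst⇒split-embedding
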